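{- Let $\pi,\tau\in S_n$ be independent and uniformly random, let $Z(a,b)=\sum_{i\le a,\,j\le b}(M_\pi(i,j)-M_\tau(i,j))$ for integers $0\le a,b\le n$ (so $Z(a,b)=0$ if $a=0$ or $b=0$), and let $N=\lceil n/2\rceil$. Define the events $\mathcal{E}_1=\{Z(a,b)\ge0 \ \forall (a,b)\in[N]\times[N]\}$, $\mathcal{E}_2=\{Z(a,b)\ge0\ \forall (a,b)\in[n-N,n]\times[N]\}$, $\mathcal{E}_3=\{Z(a,b)\ge0\ \forall (a,b)\in[N]\times[n-N,n]\}$, $\mathcal{E}_4=\{Z(a,b)\ge0\ \forall (a,b)\in[n-N,n]\times[n-N,n]\}$. Then $\mathbb{P}(\mathcal{E}_1)=\mathbb{P}(\mathcal{E}_2)=\mathbb{P}(\mathcal{E}_3)=\mathbb{P}(\mathcal{E}_4)$.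
   Context: $M_\sigma(i,j)=1$ if $\sigma(i)=j$ and $0$ otherwise. $[N]=\{1,\dots,N\}$ and $[m,n]$ denotes the integers $j$ with $m\le j\le n$. -}

module Defs where

open import Data.Bool using (Bool; true; false; T?; if_then_else_)
open import Data.Nat using (ℕ; zero; suc; _+_; _∸_; _<?_; ⌈_/2⌉)
open import Data.Fin using (Fin; toℕ)
open import Data.Fin.Properties using () renaming (_≟_ to _≟ᶠ_)
open import Data.Integer using (ℤ; _-_; 0ℤ; 1ℤ) renaming (_+_ to _+ℤ_) renaming (_≤?_ to _≤ℤ?_)
open import Data.List using (List; []; _∷_; map; concatMap; filter; length; allFin; foldr; cartesianProduct; applyUpTo)
open import Data.Bool.ListAction using (all)
open import Data.Vec using (Vec; []; _∷_; lookup)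
open import Data.Product using (_×_; _,_)
open import Relation.Nullary.Decidable using (does)

allVecs : (k n : ℕ) → List (Vec (Fin n) k)
allVecs zero    n = [] ∷ []
allVecs (suc k) n = concatMap (λ x → map (x ∷_) (allVecs k n)) (allFin n)

-- σ : Vec (Fin n) n represents the map [n] → [n], i+1 ↦ (lookup σ i)+1
-- (0-indexed Fin encodes 1-indexed [n]).  It is a permutation iff injective.
isPerm : {n : ℕ} → Vec (Fin n) n → Bool
isPerm {n} σ = all (λ i → all (λ j →
  if does (lookup σ i ≟ᶠ lookup σ j) then does (i ≟ᶠ j) else true) (allFin n)) (allFin n)

Perms : (n : ℕ) → List (Vec (Fin n) n)
Perms n = filter (λ σ → T? (isPerm σ)) (allVecs n n)

M : {n : ℕ} → Vec (Fin n) n → Fin n → Fin n → ℤ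
M σ i j = if does (lookup σ i ≟ᶠ j) then 1ℤ else 0ℤ

-- Z(a,b) = Σ_{i ≤ a, j ≤ b} (M_π(i,j) - M_τ(i,j)), for 0 ≤ a,b ≤ n
-- (i, j range over [n] ∩ [1,a], [n] ∩ [1,b]; in 0-indexed Fin: toℕ i < a).
Z : {n : ℕ} → Vec (Fin n) n → Vec (Fin n) n → ℕ → ℕ → ℤ
Z {n} π τ a b =
  foldr _+ℤ_ 0ℤ (concatMap (λ i → concatMap (λ j → (M π i j - M τ i j) ∷ [])
         (filter (λ j → toℕ j <? b) (allFin n)))
       (filter (λ i → toℕ i <? a) (allFin n)))

-- The integer interval [m,k] = {m, m+1, …, k} (empty if k < m).
range : ℕ → ℕ → List ℕ
range m k = applyUpTo (λ t → m + t) (suc k ∸ m)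

ZNonneg : {n : ℕ} → List ℕ → List ℕ → Vec (Fin n) n × Vec (Fin n) n → Bool
ZNonneg A B (π , τ) = all (λ a → all (λ b → does (0ℤ ≤ℤ? Z π τ a b)) B) A

Nh : ℕ → ℕ
Nh n = ⌈ n /2⌉

E₁ E₂ E₃ E₄ : (n : ℕ) → Vec (Fin n) n × Vec (Fin n) n → Bool
E₁ n = ZNonneg (range 1 (Nh n))       (range 1 (Nh n))
E₂ n = ZNonneg (range (n ∸ Nh n) n)   (range 1 (Nh n))
E₃ n = ZNonneg (range 1 (Nh n))       (range (n ∸ Nh n) n)
E₄ n = ZNonneg (range (n ∸ Nh n) n)   (range (n ∸ Nh n) n)

-- Number of pairs (π, τ) ∈ S_n × S_n in the event E.  Since (π, τ) is
-- uniform on S_n × S_n, ℙ(E) = count n E / (n!)².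
count : (n : ℕ) → (Vec (Fin n) n × Vec (Fin n) n → Bool) → ℕ
count n E = length (filter (λ p → T? (E p)) (cartesianProduct (Perms n) (Perms n)))

module Submission where

-- Reversing the rows of both permutation matrices, i ↦ n + 1 − i, turns Z_{π,τ}(a,b) into
-- Z_{τ,π}(n − a, b): a permutation matrix has exactly b points in the columns [1,b], so its
-- count in the rows (n − a, n] is b minus its count in the rows [1, n − a], and b cancels
-- in the difference Z.  Reversing the columns likewise turns Z_{π,τ}(a,b) into Z_{τ,π}(a, n − b).
-- Each of these, followed by swapping π and τ, is a bijection of S_n × S_n, and a ↦ n − a maps
-- [n − N, n] onto [0, N], where the extra value 0 costs nothing since Z vanishes there.  Hence
-- the row reversal carries E₂ to E₁ and E₄ to E₃, and the column reversal carries E₃ to E₁.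

open import Defs
open import Algebra.Bundles using (CommutativeMonoid)
open import Data.Bool using (Bool; true; false; T; T?; if_then_else_)
open import Data.Bool.ListAction using (all; and)
open import Data.Bool.Properties using (if-swap-then)
open import Data.Empty using (⊥; ⊥-elim)
open import Data.Fin using (Fin; zero; suc; toℕ; fromℕ; inject₁; opposite; punchOut)
open import Data.Fin.Permutation as Permutation using (Permutation′; _⟨$⟩ʳ_; permutation)
open import Data.Fin.Properties
  using (_≟_; any?; injective⇒≤; punchOut-injective; opposite-involutive; opposite-prop; toℕ<n)
open import Data.Integer using (ℤ; 0ℤ; 1ℤ)
  renaming (_+_ to _+ℤ_; _-_ to _-ℤ_; _≤?_ to _≤ℤ?_)
import Data.Integer.Properties as ℤ
open import Data.Integer.Tactic.RingSolver using (solve-∀)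
open import Data.List
  using (List; []; _∷_; _++_; map; concatMap; filter; foldr; tabulate; allFin; cartesianProduct; length)
import Data.List.Properties as List
open import Data.List.Membership.Propositional using (_∈_)
open import Data.List.Membership.Propositional.Properties using (∈-filter⁻)
open import Data.List.Relation.Unary.All using (universal)
open import Data.List.Relation.Unary.All.Properties
  using (all⁺; all⁻; tabulate⁺; tabulate⁻; applyUpTo⁺₁; applyUpTo⁻)
open import Data.List.Relation.Unary.Any using (here; there)
open import Data.Nat using (ℕ; zero; suc; 2+; z≤n; s≤s; s≤s⁻¹; _+_; _∸_; _≤_; _<_; _<?_)
import Data.Nat.Properties as ℕ
open import Data.Nat.Properties
  using ( 1+n≰n; n≮0; <⇒≤; <⇒≱; ≮⇒≥; ≤-trans; +-comm; +-suc; m≤m+n; m∸n≤m; ∸-monoˡ-<; ∸-monoʳ-≤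
        ; m+[n∸m]≡n; m∸[m∸n]≡n; m∸n≢0⇒n<m; m+n≤o⇒m≤o∸n; m≤o∸n⇒m+n≤o; ⌈n/2⌉≤n)
open import Data.Product using (_×_; _,_; proj₁; proj₂; ∃)
open import Data.Unit using (tt)
open import Data.Vec using (Vec; []; _∷_; _∷ʳ_; lookup; reverse) renaming (map to vmap)
open import Data.Vec.Properties using (reverse-∷; reverse-involutive; lookup-map; map-∘; map-cong; map-id)
open import Function using (_∘_; id; _⇔_; mk⇔; Equivalence)
open import Function.Definitions using (Injective)
open import Level using (Level)
open import Relation.Binary.PropositionalEquality
  using (_≡_; _≢_; refl; sym; trans; cong; cong₂; subst; module ≡-Reasoning)
open import Relation.Nullary using (¬_; Dec; yes; no; does; contradiction)
open import Relation.Unary using (Pred; Decidable)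

module CommutativeMonoidSums {c ℓ} (M : CommutativeMonoid c ℓ) where

  open CommutativeMonoid M
    using (Carrier; _≈_; _∙_; ε; ∙-cong; ∙-congˡ; identityˡ; identityʳ; assoc; commutativeSemigroup)
    renaming (refl to ≈-refl; sym to ≈-sym; trans to ≈-trans)
  open import Algebra.Properties.CommutativeMonoid.Sum M using (sum-syntax; ∑-permute; sum-replicate-zero)
  open import Algebra.Properties.CommutativeSemigroup commutativeSemigroup using (interchange)

  private variable
    a p : Level
    A B : Set a

  sumBy : (A → Carrier) → List A → Carrier
  sumBy f = foldr (λ x s → f x ∙ s) ε

  syntax sumBy (λ x → e) xs = ∑[ x ∈ xs ] e

  sumBy-cong : {f g : A → Carrier} (xs : List A) → (∀ {x} → x ∈ xs → f x ≈ g x) → sumBy f xs ≈ sumBy g xs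
  sumBy-cong []       f≈g = ≈-refl
  sumBy-cong (x ∷ xs) f≈g = ∙-cong (f≈g (here refl)) (sumBy-cong xs (f≈g ∘ there))

  sumBy-ε : (xs : List A) → ∑[ x ∈ xs ] ε ≈ ε
  sumBy-ε []       = ≈-refl
  sumBy-ε (x ∷ xs) = ≈-trans (identityˡ _) (sumBy-ε xs)

  sumBy-++ : (f : A → Carrier) (xs ys : List A) → sumBy f (xs ++ ys) ≈ sumBy f xs ∙ sumBy f ys
  sumBy-++ f []       ys = ≈-sym (identityˡ _)
  sumBy-++ f (x ∷ xs) ys = ≈-trans (∙-congˡ (sumBy-++ f xs ys)) (≈-sym (assoc _ _ _))

  sumBy-map : (f : B → Carrier) (g : A → B) (xs : List A) → sumBy f (map g xs) ≈ sumBy (f ∘ g) xs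
  sumBy-map f g []       = ≈-refl
  sumBy-map f g (x ∷ xs) = ∙-congˡ (sumBy-map f g xs)

  sumBy-concatMap : (f : B → Carrier) (g : A → List B) (xs : List A) →
                    sumBy f (concatMap g xs) ≈ ∑[ x ∈ xs ] sumBy f (g x)
  sumBy-concatMap f g []       = ≈-refl
  sumBy-concatMap f g (x ∷ xs) = ≈-trans (sumBy-++ f (g x) _) (∙-congˡ (sumBy-concatMap f g xs))

  sumBy-filter : {P : Pred A p} (P? : Decidable P) (f : A → Carrier) (xs : List A) →
                 sumBy f (filter P? xs) ≈ ∑[ x ∈ xs ] (if does (P? x) then f x else ε)
  sumBy-filter P? f []       = ≈-refl
  sumBy-filter P? f (x ∷ xs) with does (P? x)
  ... | true  = ∙-congˡ (sumBy-filter P? f xs)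
  ... | false = ≈-trans (sumBy-filter P? f xs) (≈-sym (identityˡ _))

  sumBy-distrib : (f g : A → Carrier) (xs : List A) → ∑[ x ∈ xs ] (f x ∙ g x) ≈ sumBy f xs ∙ sumBy g xs
  sumBy-distrib f g []       = ≈-sym (identityˡ ε)
  sumBy-distrib f g (x ∷ xs) = ≈-trans (∙-congˡ (sumBy-distrib f g xs)) (interchange (f x) (g x) _ _)

  sumBy-comm : (f : A → B → Carrier) (xs : List A) (ys : List B) →
               ∑[ x ∈ xs ] ∑[ y ∈ ys ] f x y ≈ ∑[ y ∈ ys ] ∑[ x ∈ xs ] f x y
  sumBy-comm f []       ys = ≈-sym (sumBy-ε ys)
  sumBy-comm f (x ∷ xs) ys = ≈-trans (∙-congˡ (sumBy-comm f xs ys)) (≈-sym (sumBy-distrib (f x) _ ys))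

  sumBy-cartesianProduct : (f : A × B → Carrier) (xs : List A) (ys : List B) →
                           sumBy f (cartesianProduct xs ys) ≈ ∑[ x ∈ xs ] ∑[ y ∈ ys ] f (x , y)
  sumBy-cartesianProduct f []       ys = ≈-refl
  sumBy-cartesianProduct f (x ∷ xs) ys =
    ≈-trans (sumBy-++ f (map (x ,_) ys) _) (∙-cong (sumBy-map f (x ,_) ys) (sumBy-cartesianProduct f xs ys))

  sumBy-tabulate : ∀ {n} (f : A → Carrier) (g : Fin n → A) → sumBy f (tabulate g) ≈ ∑[ i < n ] f (g i)
  sumBy-tabulate {n = zero}  f g = ≈-refl
  sumBy-tabulate {n = suc n} f g = ∙-congˡ (sumBy-tabulate f (g ∘ suc))

  sumBy-allFin : ∀ {n} (f : Fin n → Carrier) → sumBy f (allFin n) ≈ ∑[ i < n ] f i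
  sumBy-allFin f = sumBy-tabulate f id

  sumBy-filter-allFin : ∀ {n} {P : Pred (Fin n) p} (P? : Decidable P) (f : Fin n → Carrier) →
                        sumBy f (filter P? (allFin n)) ≈ ∑[ i < n ] (if does (P? i) then f i else ε)
  sumBy-filter-allFin {n = n} P? f =
    ≈-trans (sumBy-filter P? f (allFin n)) (sumBy-allFin (λ i → if does (P? i) then f i else ε))

  sumBy-allFin-permute : ∀ {n} (π : Permutation′ n) (f : Fin n → Carrier) →
                         ∑[ i ∈ allFin n ] f (π ⟨$⟩ʳ i) ≈ sumBy f (allFin n)
  sumBy-allFin-permute π f =
    ≈-trans (sumBy-allFin (f ∘ (π ⟨$⟩ʳ_))) (≈-trans (≈-sym (∑-permute f π)) (≈-sym (sumBy-allFin f)))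

  ∑-δ : ∀ {n} (x : Fin n) (g : Fin n → Carrier) → ∑[ j < n ] (if does (x ≟ j) then g j else ε) ≈ g x
  ∑-δ {suc n} zero    g = ≈-trans (∙-congˡ (sum-replicate-zero n)) (identityʳ (g zero))
  ∑-δ {suc n} (suc x) g = ≈-trans (identityˡ _) (∑-δ x (g ∘ suc))

private variable
  a p q : Level
  A : Set a
  P : Set p
  Q : Set q

T-injective : {x y : Bool} → (T x → T y) → (T y → T x) → x ≡ y
T-injective {false} {false} _ _ = refl
T-injective {false} {true}  _ g = ⊥-elim (g tt)
T-injective {true}  {false} f _ = ⊥-elim (f tt)
T-injective {true}  {true}  _ _ = refl

T-if-does : (P? : Dec P) (Q? : Dec Q) → T (if does P? then does Q? else true) ⇔ (P → Q)
T-if-does (yes _) (yes q) = mk⇔ (λ _ _ → q) (λ _ → tt)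
T-if-does (yes p) (no ¬q) = mk⇔ (λ ()) (λ p⇒q → ¬q (p⇒q p))
T-if-does (no ¬p) _       = mk⇔ (λ _ p → contradiction p ¬p) (λ _ → tt)

T-all-allFin : ∀ {n} (p : Fin n → Bool) → T (all p (allFin n)) ⇔ (∀ i → T (p i))
T-all-allFin p = mk⇔ (λ h → tabulate⁻ (all⁺ p _ h)) (λ h → all⁻ p (tabulate⁺ h))

<∸⇒+< : ∀ {m n t} → t < n ∸ m → m + t < n
<∸⇒+< {m} {n} {t} t<n∸m = subst (_≤ n) (cong suc (+-comm t m)) (m≤o∸n⇒m+n≤o (suc t) m≤n t<n∸m)
  where
  m≤n : m ≤ n
  m≤n = <⇒≤ (m∸n≢0⇒n<m (λ n∸m≡0 → n≮0 (subst (t <_) n∸m≡0 t<n∸m)))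

T-all-range : (g : ℕ → Bool) (m k : ℕ) → T (all g (range m k)) ⇔ (∀ a → m ≤ a → a ≤ k → T (g a))
T-all-range g m k = mk⇔
  (λ h a m≤a a≤k → subst (T ∘ g) (m+[n∸m]≡n m≤a)
     (applyUpTo⁻ (m +_) (suc k ∸ m) (all⁺ g _ h) (∸-monoˡ-< (s≤s a≤k) m≤a)))
  (λ h → all⁻ g (applyUpTo⁺₁ (m +_) (suc k ∸ m) λ {t} t<1+k-m →
     h (m + t) (m≤m+n m t) (s≤s⁻¹ (<∸⇒+< t<1+k-m))))

all-cong : {p q : A → Bool} (xs : List A) → (∀ x → p x ≡ q x) → all p xs ≡ all q xs
all-cong xs p≗q = cong and (List.map-cong p≗q xs)

all-range-reflect : ∀ {n N} (g : ℕ → Bool) → N ≤ n → T (g 0) →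
                    all (λ a → g (n ∸ a)) (range (n ∸ N) n) ≡ all g (range 1 N)
all-range-reflect {n} {N} g N≤n g0 = T-injective
  (λ h → Equivalence.from (T-all-range g 1 N) λ a _ a≤N →
     subst (T ∘ g) (m∸[m∸n]≡n (≤-trans a≤N N≤n))
       (Equivalence.to (T-all-range _ (n ∸ N) n) h (n ∸ a) (∸-monoʳ-≤ n a≤N) (m∸n≤m n a)))
  (λ h → Equivalence.from (T-all-range _ (n ∸ N) n) λ a n-N≤a _ →
     g-on-[0,N] h (n ∸ a) (subst (n ∸ a ≤_) (m∸[m∸n]≡n N≤n) (∸-monoʳ-≤ n n-N≤a)))
  where
  g-on-[0,N] : T (all g (range 1 N)) → ∀ x → x ≤ N → T (g x)
  g-on-[0,N] h zero    _   = g0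
  g-on-[0,N] h (suc x) x<N = Equivalence.to (T-all-range g 1 N) h (suc x) (s≤s z≤n) x<N

opposite-injective : ∀ {n} → Injective _≡_ _≡_ (opposite {n})
opposite-injective {x = i} {j} eq =
  trans (sym (opposite-involutive i)) (trans (cong opposite eq) (opposite-involutive j))

injective⇒surjective : ∀ {n} {f : Fin n → Fin n} → Injective _≡_ _≡_ f → ∀ y → ∃ λ x → f x ≡ y
injective⇒surjective {suc n} {f} f-injective y with any? (λ x → f x ≟ y)
... | yes hit  = hit
... | no  miss = contradiction (injective⇒≤ punchOut∘f-injective) 1+n≰n
  where
  y≢f : ∀ x → y ≢ f x
  y≢f x y≡fx = miss (x , sym y≡fx)
  punchOut∘f-injective : Injective _≡_ _≡_ (λ x → punchOut (y≢f x))
  punchOut∘f-injective eq = f-injective (punchOut-injective (y≢f _) (y≢f _) eq)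

injective⇒permutation : ∀ {n} {f : Fin n → Fin n} → Injective _≡_ _≡_ f → Permutation′ n
injective⇒permutation {f = f} f-injective =
  permutation f (proj₁ ∘ surj) (proj₂ ∘ surj) (λ x → f-injective (proj₂ (surj (f x))))
  where
  surj : ∀ y → ∃ λ x → f x ≡ y
  surj = injective⇒surjective f-injective

lookup-∷ʳ-fromℕ : ∀ {k} (v : Vec A k) x → lookup (v ∷ʳ x) (fromℕ k) ≡ x
lookup-∷ʳ-fromℕ []      x = refl
lookup-∷ʳ-fromℕ (_ ∷ v) x = lookup-∷ʳ-fromℕ v x

lookup-∷ʳ-inject₁ : ∀ {k} (v : Vec A k) x i → lookup (v ∷ʳ x) (inject₁ i) ≡ lookup v i
lookup-∷ʳ-inject₁ (_ ∷ v) x zero    = refl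
lookup-∷ʳ-inject₁ (_ ∷ v) x (suc i) = lookup-∷ʳ-inject₁ v x i

lookup-reverse-opposite : ∀ {k} (v : Vec A k) i → lookup (reverse v) (opposite i) ≡ lookup v i
lookup-reverse-opposite (x ∷ v) zero    rewrite reverse-∷ x v = lookup-∷ʳ-fromℕ (reverse v) x
lookup-reverse-opposite (x ∷ v) (suc i) rewrite reverse-∷ x v =
  trans (lookup-∷ʳ-inject₁ (reverse v) x (opposite i)) (lookup-reverse-opposite v i)

lookup-reverse : ∀ {k} (v : Vec A k) i → lookup (reverse v) i ≡ lookup v (opposite i)
lookup-reverse v i =
  trans (cong (lookup (reverse v)) (sym (opposite-involutive i))) (lookup-reverse-opposite v (opposite i))

map-opposite-involutive : ∀ {n k} (v : Vec (Fin n) k) → vmap opposite (vmap opposite v) ≡ v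
map-opposite-involutive v =
  trans (sym (map-∘ opposite opposite v)) (trans (map-cong opposite-involutive v) (map-id v))

isPerm⇔injective : ∀ {n} (σ : Vec (Fin n) n) → T (isPerm σ) ⇔ Injective _≡_ _≡_ (lookup σ)
isPerm⇔injective σ = mk⇔
  (λ h {i} {j} → Equivalence.to (T-if-does (lookup σ i ≟ lookup σ j) (i ≟ j))
     (Equivalence.to (T-all-allFin _) (Equivalence.to (T-all-allFin _) h i) j))
  (λ σ-injective → Equivalence.from (T-all-allFin _) λ i → Equivalence.from (T-all-allFin _) λ j →
     Equivalence.from (T-if-does (lookup σ i ≟ lookup σ j) (i ≟ j)) σ-injective)

∈-Perms⇒injective : ∀ {n} {σ : Vec (Fin n) n} → σ ∈ Perms n → Injective _≡_ _≡_ (lookup σ)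
∈-Perms⇒injective {n} {σ} σ∈ =
  Equivalence.to (isPerm⇔injective σ) (proj₂ (∈-filter⁻ (T? ∘ isPerm) {xs = allVecs n n} σ∈))

isPerm-invariant : ∀ {n} (ρ : Vec (Fin n) n → Vec (Fin n) n) → (∀ σ → ρ (ρ σ) ≡ σ) →
                   (∀ σ → Injective _≡_ _≡_ (lookup σ) → Injective _≡_ _≡_ (lookup (ρ σ))) →
                   ∀ σ → isPerm (ρ σ) ≡ isPerm σ
isPerm-invariant ρ ρ-involutive ρ-injective σ = T-injective
  (λ h → from σ (subst (Injective _≡_ _≡_ ∘ lookup) (ρ-involutive σ) (ρ-injective (ρ σ) (to (ρ σ) h))))
  (λ h → from (ρ σ) (ρ-injective σ (to σ h)))
  where
  to : ∀ σ → T (isPerm σ) → Injective _≡_ _≡_ (lookup σ)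
  to σ = Equivalence.to (isPerm⇔injective σ)
  from : ∀ σ → Injective _≡_ _≡_ (lookup σ) → T (isPerm σ)
  from σ = Equivalence.from (isPerm⇔injective σ)

isPerm-reverse : ∀ {n} (σ : Vec (Fin n) n) → isPerm (reverse σ) ≡ isPerm σ
isPerm-reverse = isPerm-invariant reverse reverse-involutive λ σ σ-injective {i} {j} eq →
  opposite-injective (σ-injective (trans (sym (lookup-reverse σ i)) (trans eq (lookup-reverse σ j))))

isPerm-map-opposite : ∀ {n} (σ : Vec (Fin n) n) → isPerm (vmap opposite σ) ≡ isPerm σ
isPerm-map-opposite = isPerm-invariant (vmap opposite) map-opposite-involutive λ σ σ-injective {i} {j} eq →
  σ-injective (opposite-injective (trans (sym (lookup-map i opposite σ)) (trans eq (lookup-map j opposite σ))))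

module Counting where

  open CommutativeMonoidSums ℕ.+-0-commutativeMonoid

  SumInvariant : {A : Set} → List A → (A → A) → Set
  SumInvariant xs ρ = ∀ h → ∑[ x ∈ xs ] h (ρ x) ≡ sumBy h xs

  length≡∑1 : (xs : List A) → length xs ≡ ∑[ x ∈ xs ] 1
  length≡∑1 []       = refl
  length≡∑1 (x ∷ xs) = cong suc (length≡∑1 xs)

  count-as-sum : ∀ n (E : Vec (Fin n) n × Vec (Fin n) n → Bool) →
                 count n E ≡ ∑[ π ∈ Perms n ] ∑[ τ ∈ Perms n ] (if E (π , τ) then 1 else 0)
  count-as-sum n E = begin
    count n E                                                       ≡⟨ length≡∑1 (filter (T? ∘ E) pairs) ⟩
    sumBy (λ _ → 1) (filter (T? ∘ E) pairs)                         ≡⟨ sumBy-filter (T? ∘ E) (λ _ → 1) pairs ⟩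
    ∑[ p ∈ pairs ] (if E p then 1 else 0)                           ≡⟨ sumBy-cartesianProduct _ (Perms n) (Perms n) ⟩
    ∑[ π ∈ Perms n ] ∑[ τ ∈ Perms n ] (if E (π , τ) then 1 else 0)  ∎
    where
    open ≡-Reasoning
    pairs : List (Vec (Fin n) n × Vec (Fin n) n)
    pairs = cartesianProduct (Perms n) (Perms n)

  module _ {n : ℕ} where

    sumBy-allVecs-∷ : ∀ k (h : Vec (Fin n) (suc k) → ℕ) →
                      sumBy h (allVecs (suc k) n) ≡ ∑[ x ∈ allFin n ] ∑[ v ∈ allVecs k n ] h (x ∷ v)
    sumBy-allVecs-∷ k h = trans (sumBy-concatMap h _ (allFin n))
                                (sumBy-cong (allFin n) λ {x} _ → sumBy-map h (x ∷_) (allVecs k n))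

    sumBy-allVecs-∷ʳ : ∀ k (h : Vec (Fin n) (suc k) → ℕ) →
                       sumBy h (allVecs (suc k) n) ≡ ∑[ v ∈ allVecs k n ] ∑[ x ∈ allFin n ] h (v ∷ʳ x)
    sumBy-allVecs-∷ʳ zero    h =
      trans (sumBy-allVecs-∷ zero h) (sumBy-comm (λ x v → h (x ∷ v)) (allFin n) (allVecs zero n))
    sumBy-allVecs-∷ʳ (suc k) h = begin
      sumBy h (allVecs (2+ k) n)
        ≡⟨ sumBy-allVecs-∷ (suc k) h ⟩
      ∑[ x ∈ allFin n ] ∑[ v ∈ allVecs (suc k) n ] h (x ∷ v)
        ≡⟨ sumBy-cong (allFin n) (λ {x} _ → sumBy-allVecs-∷ʳ k (h ∘ (x ∷_))) ⟩
      ∑[ x ∈ allFin n ] ∑[ v ∈ allVecs k n ] ∑[ y ∈ allFin n ] h (x ∷ (v ∷ʳ y))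
        ≡⟨ sumBy-allVecs-∷ k (λ w → ∑[ y ∈ allFin n ] h (w ∷ʳ y)) ⟨
      ∑[ w ∈ allVecs (suc k) n ] ∑[ y ∈ allFin n ] h (w ∷ʳ y)
        ∎
      where open ≡-Reasoning

    sumBy-allVecs-reverse : ∀ k → SumInvariant (allVecs k n) reverse
    sumBy-allVecs-reverse zero    h = refl
    sumBy-allVecs-reverse (suc k) h = begin
      ∑[ v ∈ allVecs (suc k) n ] h (reverse v)
        ≡⟨ sumBy-allVecs-∷ k (h ∘ reverse) ⟩
      ∑[ x ∈ allFin n ] ∑[ v ∈ allVecs k n ] h (reverse (x ∷ v))
        ≡⟨ sumBy-cong (allFin n) (λ {x} _ → sumBy-cong (allVecs k n) λ {v} _ → cong h (reverse-∷ x v)) ⟩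
      ∑[ x ∈ allFin n ] ∑[ v ∈ allVecs k n ] h (reverse v ∷ʳ x)
        ≡⟨ sumBy-cong (allFin n) (λ {x} _ → sumBy-allVecs-reverse k (h ∘ (_∷ʳ x))) ⟩
      ∑[ x ∈ allFin n ] ∑[ v ∈ allVecs k n ] h (v ∷ʳ x)
        ≡⟨ sumBy-comm _ (allFin n) (allVecs k n) ⟩
      ∑[ v ∈ allVecs k n ] ∑[ x ∈ allFin n ] h (v ∷ʳ x)
        ≡⟨ sumBy-allVecs-∷ʳ k h ⟨
      sumBy h (allVecs (suc k) n)
        ∎
      where open ≡-Reasoning

    sumBy-allVecs-map : (π : Permutation′ n) → ∀ k → SumInvariant (allVecs k n) (vmap (π ⟨$⟩ʳ_))
    sumBy-allVecs-map π zero    h = refl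
    sumBy-allVecs-map π (suc k) h = begin
      ∑[ v ∈ allVecs (suc k) n ] h (vmap (π ⟨$⟩ʳ_) v)
        ≡⟨ sumBy-allVecs-∷ k _ ⟩
      ∑[ x ∈ allFin n ] ∑[ v ∈ allVecs k n ] h ((π ⟨$⟩ʳ x) ∷ vmap (π ⟨$⟩ʳ_) v)
        ≡⟨ sumBy-cong (allFin n) (λ {x} _ → sumBy-allVecs-map π k (h ∘ ((π ⟨$⟩ʳ x) ∷_))) ⟩
      ∑[ x ∈ allFin n ] ∑[ v ∈ allVecs k n ] h ((π ⟨$⟩ʳ x) ∷ v)
        ≡⟨ sumBy-allFin-permute π (λ y → ∑[ v ∈ allVecs k n ] h (y ∷ v)) ⟩
      ∑[ x ∈ allFin n ] ∑[ v ∈ allVecs k n ] h (x ∷ v)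
        ≡⟨ sumBy-allVecs-∷ k h ⟨
      sumBy h (allVecs (suc k) n)
        ∎
      where open ≡-Reasoning

    sumBy-Perms-invariant : (ρ : Vec (Fin n) n → Vec (Fin n) n) → SumInvariant (allVecs n n) ρ →
                            (∀ v → isPerm (ρ v) ≡ isPerm v) → SumInvariant (Perms n) ρ
    sumBy-Perms-invariant ρ ρ-invariant isPerm-ρ h = begin
      ∑[ σ ∈ Perms n ] h (ρ σ)
        ≡⟨ sumBy-filter (T? ∘ isPerm) (h ∘ ρ) (allVecs n n) ⟩
      ∑[ v ∈ allVecs n n ] (if isPerm v then h (ρ v) else 0)
        ≡⟨ sumBy-cong (allVecs n n) (λ {v} _ → cong (λ b → if b then h (ρ v) else 0) (isPerm-ρ v)) ⟨
      ∑[ v ∈ allVecs n n ] (if isPerm (ρ v) then h (ρ v) else 0)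
        ≡⟨ ρ-invariant (λ w → if isPerm w then h w else 0) ⟩
      ∑[ v ∈ allVecs n n ] (if isPerm v then h v else 0)
        ≡⟨ sumBy-filter (T? ∘ isPerm) h (allVecs n n) ⟨
      sumBy h (Perms n)
        ∎
      where open ≡-Reasoning

    count-respects-symmetry : (ρ : Vec (Fin n) n → Vec (Fin n) n) → SumInvariant (Perms n) ρ →
                              (E E′ : Vec (Fin n) n × Vec (Fin n) n → Bool) →
                              (∀ {π τ} → π ∈ Perms n → τ ∈ Perms n → E′ (ρ π , ρ τ) ≡ E (τ , π)) →
                              count n E′ ≡ count n E
    count-respects-symmetry ρ ρ-invariant E E′ E′∘ρ≡E∘swap = begin
      count n E′                                            ≡⟨ count-as-sum n E′ ⟩
      ∑[ π ∈ Perms n ] ∑[ τ ∈ Perms n ] [ E′ (π , τ) ]      ≡⟨ ρ-invariant _ ⟨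
      ∑[ π ∈ Perms n ] ∑[ τ ∈ Perms n ] [ E′ (ρ π , τ) ]    ≡⟨ sumBy-cong (Perms n) (λ _ → ρ-invariant _) ⟨
      ∑[ π ∈ Perms n ] ∑[ τ ∈ Perms n ] [ E′ (ρ π , ρ τ) ]  ≡⟨ sumBy-cong (Perms n) (λ π∈ → sumBy-cong (Perms n) λ τ∈ →
                                                                  cong [_] (E′∘ρ≡E∘swap π∈ τ∈)) ⟩
      ∑[ π ∈ Perms n ] ∑[ τ ∈ Perms n ] [ E (τ , π) ]       ≡⟨ sumBy-comm _ (Perms n) (Perms n) ⟩
      ∑[ τ ∈ Perms n ] ∑[ π ∈ Perms n ] [ E (τ , π) ]       ≡⟨ count-as-sum n E ⟨
      count n E                                             ∎
      where
      open ≡-Reasoning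
      [_] : Bool → ℕ
      [ b ] = if b then 1 else 0

module Corners where

  open CommutativeMonoidSums ℤ.+-0-commutativeMonoid
  open import Algebra.Properties.CommutativeMonoid.Sum ℤ.+-0-commutativeMonoid
    using (sum-syntax; sum-cong-≗; ∑-distrib-+; ∑-permute)

  ⟦_<_⟧ : ℕ → ℕ → ℤ
  ⟦ m < k ⟧ = if does (m <? k) then 1ℤ else 0ℤ

  corner : ∀ {n} → Vec (Fin n) n → ℕ → ℕ → ℤ
  corner {n} σ a b = ∑[ i < n ] (if does (toℕ i <? a) then ⟦ toℕ (lookup σ i) < b ⟧ else 0ℤ)

  if-+ : ∀ t x y → (if t then x else 0ℤ) +ℤ (if t then y else 0ℤ) ≡ (if t then x +ℤ y else 0ℤ)
  if-+ true  x y = refl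
  if-+ false x y = refl

  if-complementary : (P? : Dec P) (Q? : Dec Q) → (P → Q → ⊥) → (¬ P → Q) → ∀ x →
                     (if does P? then x else 0ℤ) +ℤ (if does Q? then x else 0ℤ) ≡ x
  if-complementary (yes p) (yes q) p⇒¬q _    x = contradiction q (p⇒¬q p)
  if-complementary (yes _) (no _)  _    _    x = ℤ.+-identityʳ x
  if-complementary (no _)  (yes _) _    _    x = ℤ.+-identityˡ x
  if-complementary (no ¬p) (no ¬q) _    ¬p⇒q x = contradiction (¬p⇒q ¬p) ¬q

  if-opposite : ∀ {n} (j : Fin n) a x →
                (if does (toℕ (opposite j) <? a) then x else 0ℤ) +ℤ (if does (toℕ j <? n ∸ a) then x else 0ℤ) ≡ x
  if-opposite {n} j a = if-complementary (toℕ (opposite j) <? a) (toℕ j <? n ∸ a)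
    (λ j′<a j<n-a → <⇒≱ (subst (_< a) (opposite-prop j) j′<a)
       (m+n≤o⇒m≤o∸n a (subst (_≤ n) (sym (+-suc a (toℕ j))) (<∸⇒+< j<n-a))))
    (λ j′≮a → m+n≤o⇒m≤o∸n (suc (toℕ j)) (subst (_≤ n) (+-comm a _)
       (m≤o∸n⇒m+n≤o a (toℕ<n j) (subst (a ≤_) (opposite-prop j) (≮⇒≥ j′≮a)))))

  ∑-if-sub : ∀ {n} (t : Fin n → Bool) (f g : Fin n → ℤ) →
             ∑[ i < n ] (if t i then f i -ℤ g i else 0ℤ)
             ≡ ∑[ i < n ] (if t i then f i else 0ℤ) -ℤ ∑[ i < n ] (if t i then g i else 0ℤ)
  ∑-if-sub {zero}  t f g = refl
  ∑-if-sub {suc n} t f g =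
    trans (cong₂ _+ℤ_ (if-sub (t zero)) (∑-if-sub (t ∘ suc) (f ∘ suc) (g ∘ suc)))
          (sub-interchange (if t zero then f zero else 0ℤ) (if t zero then g zero else 0ℤ)
                           (∑[ i < n ] (if t (suc i) then f (suc i) else 0ℤ)) (∑[ i < n ] (if t (suc i) then g (suc i) else 0ℤ)))
    where
    if-sub : ∀ b → (if b then f zero -ℤ g zero else 0ℤ) ≡ (if b then f zero else 0ℤ) -ℤ (if b then g zero else 0ℤ)
    if-sub true  = refl
    if-sub false = refl
    sub-interchange : ∀ w x y z → (w -ℤ x) +ℤ (y -ℤ z) ≡ (w +ℤ y) -ℤ (x +ℤ z)
    sub-interchange = solve-∀

  difference-of-complements : ∀ x x′ y y′ {c} → x +ℤ x′ ≡ c → y +ℤ y′ ≡ c → x -ℤ y ≡ y′ -ℤ x′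
  difference-of-complements x x′ y y′ {c} x+x′≡c y+y′≡c = begin
    x -ℤ y                                ≡⟨ regroup x x′ y y′ ⟩
    (x +ℤ x′) -ℤ (y +ℤ y′) +ℤ (y′ -ℤ x′)  ≡⟨ cong₂ (λ u v → u -ℤ v +ℤ (y′ -ℤ x′)) x+x′≡c y+y′≡c ⟩
    c -ℤ c +ℤ (y′ -ℤ x′)                  ≡⟨ cong (_+ℤ (y′ -ℤ x′)) (ℤ.+-inverseʳ c) ⟩
    0ℤ +ℤ (y′ -ℤ x′)                      ≡⟨ ℤ.+-identityˡ _ ⟩
    y′ -ℤ x′                              ∎
    where
    open ≡-Reasoning
    regroup : ∀ x x′ y y′ → x -ℤ y ≡ (x +ℤ x′) -ℤ (y +ℤ y′) +ℤ (y′ -ℤ x′)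
    regroup = solve-∀

  ∑-row : ∀ {n} (σ : Vec (Fin n) n) b i →
          ∑[ j < n ] (if does (toℕ j <? b) then M σ i j else 0ℤ) ≡ ⟦ toℕ (lookup σ i) < b ⟧
  ∑-row {n} σ b i = trans (sum-cong-≗ {n} λ j → if-swap-then (does (toℕ j <? b)) (does (lookup σ i ≟ j)))
                          (∑-δ (lookup σ i) (λ j → ⟦ toℕ j < b ⟧))

  Z≡∑-rows : ∀ {n} (π τ : Vec (Fin n) n) a b →
             Z π τ a b ≡ ∑[ i < n ] (if does (toℕ i <? a)
                                      then ∑[ j < n ] (if does (toℕ j <? b) then M π i j -ℤ M τ i j else 0ℤ)
                                      else 0ℤ)
  Z≡∑-rows {n} π τ a b = begin
    Z π τ a b
      -- `sumBy id` is `foldr _+ℤ_ 0ℤ` up to η, so `Z` is already a `sumBy` over a `concatMap`.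
      ≡⟨ sumBy-concatMap id row (below a) ⟩
    ∑[ i ∈ below a ] sumBy id (row i)
      ≡⟨ sumBy-cong (below a) (λ {i} _ → sum-row i) ⟩
    ∑[ i ∈ below a ] sumBy (d i) (below b)
      ≡⟨ sumBy-filter-allFin {n = n} (λ i → toℕ i <? a) _ ⟩
    ∑[ i < n ] (if does (toℕ i <? a) then sumBy (d i) (below b) else 0ℤ)
      ≡⟨ sum-cong-≗ {n} (λ i → cong (λ s → if does (toℕ i <? a) then s else 0ℤ)
                                     (sumBy-filter-allFin {n = n} (λ j → toℕ j <? b) (d i))) ⟩
    ∑[ i < n ] (if does (toℕ i <? a) then ∑[ j < n ] (if does (toℕ j <? b) then d i j else 0ℤ) else 0ℤ)
      ∎
    where
    open ≡-Reasoning
    below : ℕ → List (Fin n)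
    below k = filter (λ i → toℕ i <? k) (allFin n)
    d : Fin n → Fin n → ℤ
    d i j = M π i j -ℤ M τ i j
    row : Fin n → List ℤ
    row i = concatMap (λ j → d i j ∷ []) (below b)
    sum-row : ∀ i → sumBy id (row i) ≡ sumBy (d i) (below b)
    sum-row i = trans (sumBy-concatMap id (λ j → d i j ∷ []) (below b))
                      (sumBy-cong (below b) λ {j} _ → ℤ.+-identityʳ (d i j))

  Z≡corner-corner : ∀ {n} (π τ : Vec (Fin n) n) a b → Z π τ a b ≡ corner π a b -ℤ corner τ a b
  Z≡corner-corner {n} π τ a b = begin
    Z π τ a b
      ≡⟨ Z≡∑-rows π τ a b ⟩
    ∑[ i < n ] (if does (toℕ i <? a) then ∑[ j < n ] (if does (toℕ j <? b) then M π i j -ℤ M τ i j else 0ℤ) else 0ℤ)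
      ≡⟨ sum-cong-≗ {n} (λ i → cong (λ s → if does (toℕ i <? a) then s else 0ℤ) (row-difference i)) ⟩
    ∑[ i < n ] (if does (toℕ i <? a) then ⟦ toℕ (lookup π i) < b ⟧ -ℤ ⟦ toℕ (lookup τ i) < b ⟧ else 0ℤ)
      ≡⟨ ∑-if-sub (λ i → does (toℕ i <? a)) (λ i → ⟦ toℕ (lookup π i) < b ⟧) (λ i → ⟦ toℕ (lookup τ i) < b ⟧) ⟩
    corner π a b -ℤ corner τ a b
      ∎
    where
    open ≡-Reasoning
    row-difference : ∀ i → ∑[ j < n ] (if does (toℕ j <? b) then M π i j -ℤ M τ i j else 0ℤ)
                           ≡ ⟦ toℕ (lookup π i) < b ⟧ -ℤ ⟦ toℕ (lookup τ i) < b ⟧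
    row-difference i = trans (∑-if-sub (λ j → does (toℕ j <? b)) (M π i) (M τ i)) (cong₂ _-ℤ_ (∑-row π b i) (∑-row τ b i))

  corner-map-opposite : ∀ {n} (σ : Vec (Fin n) n) a b →
                        corner (vmap opposite σ) a b +ℤ corner σ a (n ∸ b) ≡ ∑[ i < n ] ⟦ toℕ i < a ⟧
  corner-map-opposite {n} σ a b = begin
    corner (vmap opposite σ) a b +ℤ corner σ a (n ∸ b)
      ≡⟨ ∑-distrib-+ {n} _ _ ⟨
    ∑[ i < n ] ((if does (toℕ i <? a) then ⟦ toℕ (lookup (vmap opposite σ) i) < b ⟧ else 0ℤ)
                +ℤ (if does (toℕ i <? a) then ⟦ toℕ (lookup σ i) < n ∸ b ⟧ else 0ℤ))
      ≡⟨ sum-cong-≗ {n} (λ i → trans (if-+ (does (toℕ i <? a)) _ _)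
                                     (cong (λ s → if does (toℕ i <? a) then s else 0ℤ) (complement i))) ⟩
    ∑[ i < n ] ⟦ toℕ i < a ⟧
      ∎
    where
    open ≡-Reasoning
    complement : ∀ i → ⟦ toℕ (lookup (vmap opposite σ) i) < b ⟧ +ℤ ⟦ toℕ (lookup σ i) < n ∸ b ⟧ ≡ 1ℤ
    complement i rewrite lookup-map i opposite σ = if-opposite (lookup σ i) b 1ℤ

  corner-reverse : ∀ {n} (σ : Vec (Fin n) n) → Injective _≡_ _≡_ (lookup σ) → ∀ a b →
                   corner (reverse σ) a b +ℤ corner σ (n ∸ a) b ≡ ∑[ j < n ] ⟦ toℕ j < b ⟧
  corner-reverse {n} σ σ-injective a b = begin
    corner (reverse σ) a b +ℤ corner σ (n ∸ a) b
      ≡⟨ cong (_+ℤ corner σ (n ∸ a) b) (∑-permute (λ i → if does (toℕ i <? a) then ⟦ toℕ (lookup (reverse σ) i) < b ⟧ else 0ℤ)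
                                                  Permutation.reverse) ⟩
    ∑[ i < n ] (if does (toℕ (opposite i) <? a) then ⟦ toℕ (lookup (reverse σ) (opposite i)) < b ⟧ else 0ℤ)
      +ℤ corner σ (n ∸ a) b
      ≡⟨ cong (_+ℤ corner σ (n ∸ a) b) (sum-cong-≗ {n} λ i →
           cong (λ k → if does (toℕ (opposite i) <? a) then ⟦ toℕ k < b ⟧ else 0ℤ) (lookup-reverse-opposite σ i)) ⟩
    ∑[ i < n ] (if does (toℕ (opposite i) <? a) then ⟦ toℕ (lookup σ i) < b ⟧ else 0ℤ) +ℤ corner σ (n ∸ a) b
      ≡⟨ ∑-distrib-+ {n} _ _ ⟨
    ∑[ i < n ] ((if does (toℕ (opposite i) <? a) then ⟦ toℕ (lookup σ i) < b ⟧ else 0ℤ)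
                +ℤ (if does (toℕ i <? n ∸ a) then ⟦ toℕ (lookup σ i) < b ⟧ else 0ℤ))
      ≡⟨ sum-cong-≗ {n} (λ i → if-opposite i a ⟦ toℕ (lookup σ i) < b ⟧) ⟩
    ∑[ i < n ] ⟦ toℕ (lookup σ i) < b ⟧
      ≡⟨ ∑-permute (λ j → ⟦ toℕ j < b ⟧) (injective⇒permutation σ-injective) ⟨
    ∑[ j < n ] ⟦ toℕ j < b ⟧
      ∎
    where open ≡-Reasoning

  Z-map-opposite : ∀ {n} (π τ : Vec (Fin n) n) a b → Z (vmap opposite π) (vmap opposite τ) a b ≡ Z τ π a (n ∸ b)
  Z-map-opposite {n} π τ a b = begin
    Z (vmap opposite π) (vmap opposite τ) a b
      ≡⟨ Z≡corner-corner (vmap opposite π) (vmap opposite τ) a b ⟩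
    corner (vmap opposite π) a b -ℤ corner (vmap opposite τ) a b
      ≡⟨ difference-of-complements (corner (vmap opposite π) a b) (corner π a (n ∸ b))
                                   (corner (vmap opposite τ) a b) (corner τ a (n ∸ b))
                                   (corner-map-opposite π a b) (corner-map-opposite τ a b) ⟩
    corner τ a (n ∸ b) -ℤ corner π a (n ∸ b)
      ≡⟨ Z≡corner-corner τ π a (n ∸ b) ⟨
    Z τ π a (n ∸ b)
      ∎
    where open ≡-Reasoning

  Z-reverse : ∀ {n} (π τ : Vec (Fin n) n) → Injective _≡_ _≡_ (lookup π) → Injective _≡_ _≡_ (lookup τ) →
              ∀ a b → Z (reverse π) (reverse τ) a b ≡ Z τ π (n ∸ a) b
  Z-reverse {n} π τ π-injective τ-injective a b = begin
    Z (reverse π) (reverse τ) a b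
      ≡⟨ Z≡corner-corner (reverse π) (reverse τ) a b ⟩
    corner (reverse π) a b -ℤ corner (reverse τ) a b
      ≡⟨ difference-of-complements (corner (reverse π) a b) (corner π (n ∸ a) b)
                                   (corner (reverse τ) a b) (corner τ (n ∸ a) b)
                                   (corner-reverse π π-injective a b) (corner-reverse τ τ-injective a b) ⟩
    corner τ (n ∸ a) b -ℤ corner π (n ∸ a) b
      ≡⟨ Z≡corner-corner τ π (n ∸ a) b ⟨
    Z τ π (n ∸ a) b
      ∎
    where open ≡-Reasoning

  Z-zeroˡ : ∀ {n} (π τ : Vec (Fin n) n) b → Z π τ 0 b ≡ 0ℤ
  Z-zeroˡ π τ b = trans (Z≡corner-corner π τ 0 b) (ℤ.+-inverseʳ (corner π 0 b))

  Z-zeroʳ : ∀ {n} (π τ : Vec (Fin n) n) a → Z π τ a 0 ≡ 0ℤ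
  Z-zeroʳ π τ a = trans (Z≡corner-corner π τ a 0) (ℤ.+-inverseʳ (corner π a 0))

open Counting
open Corners

≡0⇒T-0≤? : ∀ {z} → z ≡ 0ℤ → T (does (0ℤ ≤ℤ? z))
≡0⇒T-0≤? refl = tt

ZNonneg-reverse : ∀ {n N} → N ≤ n → (B : List ℕ) (π τ : Vec (Fin n) n) →
                  Injective _≡_ _≡_ (lookup π) → Injective _≡_ _≡_ (lookup τ) →
                  ZNonneg (range (n ∸ N) n) B (reverse π , reverse τ) ≡ ZNonneg (range 1 N) B (τ , π)
ZNonneg-reverse {n} {N} N≤n B π τ π-injective τ-injective = trans
  (all-cong (range (n ∸ N) n) λ a → all-cong B λ b →
     cong (λ z → does (0ℤ ≤ℤ? z)) (Z-reverse π τ π-injective τ-injective a b))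
  (all-range-reflect (λ a → all (λ b → does (0ℤ ≤ℤ? Z τ π a b)) B) N≤n
     (all⁻ _ (universal (λ b → ≡0⇒T-0≤? (Z-zeroˡ τ π b)) B)))

ZNonneg-map-opposite : ∀ {n N} → N ≤ n → (A : List ℕ) (π τ : Vec (Fin n) n) →
                       ZNonneg A (range (n ∸ N) n) (vmap opposite π , vmap opposite τ) ≡ ZNonneg A (range 1 N) (τ , π)
ZNonneg-map-opposite {n} {N} N≤n A π τ = all-cong A λ a → trans
  (all-cong (range (n ∸ N) n) λ b → cong (λ z → does (0ℤ ≤ℤ? z)) (Z-map-opposite π τ a b))
  (all-range-reflect (λ b → does (0ℤ ≤ℤ? Z τ π a b)) N≤n (≡0⇒T-0≤? (Z-zeroʳ τ π a)))

lemma4p6 : (n : ℕ) →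
    (count n (E₁ n) ≡ count n (E₂ n)) × (count n (E₂ n) ≡ count n (E₃ n))
    × (count n (E₃ n) ≡ count n (E₄ n))
lemma4p6 n = sym E₂≡E₁ , trans E₂≡E₁ (sym E₃≡E₁) , sym E₄≡E₃
  where
  N≤n : Nh n ≤ n
  N≤n = ⌈n/2⌉≤n n

  reverse-invariant : SumInvariant (Perms n) reverse
  reverse-invariant = sumBy-Perms-invariant reverse (sumBy-allVecs-reverse n) isPerm-reverse

  opposite-invariant : SumInvariant (Perms n) (vmap opposite)
  opposite-invariant =
    sumBy-Perms-invariant (vmap opposite) (sumBy-allVecs-map Permutation.reverse n) isPerm-map-opposite

  E₂≡E₁ : count n (E₂ n) ≡ count n (E₁ n)
  E₂≡E₁ = count-respects-symmetry reverse reverse-invariant (E₁ n) (E₂ n) λ {π} {τ} π∈ τ∈ →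
    ZNonneg-reverse N≤n (range 1 (Nh n)) π τ (∈-Perms⇒injective π∈) (∈-Perms⇒injective τ∈)

  E₃≡E₁ : count n (E₃ n) ≡ count n (E₁ n)
  E₃≡E₁ = count-respects-symmetry (vmap opposite) opposite-invariant (E₁ n) (E₃ n) λ {π} {τ} _ _ →
    ZNonneg-map-opposite N≤n (range 1 (Nh n)) π τ

  E₄≡E₃ : count n (E₄ n) ≡ count n (E₃ n)
  E₄≡E₃ = count-respects-symmetry reverse reverse-invariant (E₃ n) (E₄ n) λ {π} {τ} π∈ τ∈ →
    ZNonneg-reverse N≤n (range (n ∸ Nh n) n) π τ (∈-Perms⇒injective π∈) (∈-Perms⇒injective τ∈)
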